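{- Let $k\subseteq K\subseteq L\subseteq L'\subseteq\overline{k}$ be a tower of fields. Then $L'/K$ is pure if and only if both $L'/L$ and $L/K$ are pure.
   Context: Let $q$ be a prime power, $k=\mathbb{F}_q(T)$, $R_T=\mathbb{F}_q[T]$, and $\overline{k}$ an algebraic closure of $k$. The Carlitz–Hayes action of $R_T$ on $\overline{k}$ is defined, for $u\in\overline{k}$ and $N\in R_T$, by $u^{N}:=N(\varphi+\mu_T)(u)$, where $\varphi(u)=u^{q}$ and $\mu_T(u)=Tu$. An extension $F_2/F_1$ of such fields is pure if for every monic irreducible $P\in R_T$ and every $u\in F_2$ with $u^{P}=0$ one has $u\in F_1$. -}

module Defs where

open import Level using (Level; _⊔_)
open import Data.Nat as ℕ using (ℕ; zero; suc; _≤_; _<_; _^_)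
open import Relation.Binary.PropositionalEquality using (_≡_)
open import Data.Nat.Primality using (Prime)
open import Data.List using (List; []; _∷_)
open import Data.Product using (Σ; ∃; _×_; _,_)
open import Data.Sum using (_⊎_)
open import Relation.Nullary using (¬_)
open import Relation.Unary using (Pred)
open import Algebra.Bundles using (CommutativeRing)

-- Everything happens inside an ambient commutative ring Ω (standing for k̄),
-- with a fixed natural number q and a fixed element T of Ω.
module Carlitz {c ℓ : Level} (Ω : CommutativeRing c ℓ) (q : ℕ) (T : CommutativeRing.Carrier Ω) where
  open CommutativeRing Ω

  pow : Carrier → ℕ → Carrier
  pow x zero    = 1#
  pow x (suc n) = x * pow x n

  natMul : ℕ → Carrier
  natMul zero    = 0#
  natMul (suc n) = 1# + natMul n

  IsField : Set (c ⊔ ℓ)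
  IsField = (¬ (1# ≈ 0#)) × (∀ x → ¬ (x ≈ 0#) → ∃ λ y → x * y ≈ 1#)

  -- 𝔽_q inside Ω: the roots of X^q - X
  InFq : Pred Carrier ℓ
  InFq x = pow x q ≈ x

  -- Polynomials with coefficients in Ω as coefficient lists (constant term first)
  Poly : Set c
  Poly = List Carrier

  coeff : Poly → ℕ → Carrier
  coeff []       n       = 0#
  coeff (a ∷ p)  zero    = a
  coeff (a ∷ p)  (suc n) = coeff p n

  CoeffsIn : {a : Level} → Pred Carrier a → Poly → Set a
  CoeffsIn S p = ∀ n → S (coeff p n)

  FqPoly : Poly → Set ℓ
  FqPoly = CoeffsIn InFq

  _≈ₚ_ : Poly → Poly → Set ℓ
  p ≈ₚ r = ∀ n → coeff p n ≈ coeff r n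

  addP : Poly → Poly → Poly
  addP []      r       = r
  addP (a ∷ p) []      = a ∷ p
  addP (a ∷ p) (b ∷ r) = (a + b) ∷ addP p r

  scaleP : Carrier → Poly → Poly
  scaleP a []      = []
  scaleP a (b ∷ r) = (a * b) ∷ scaleP a r

  mulP : Poly → Poly → Poly
  mulP []      r = []
  mulP (a ∷ p) r = addP (scaleP a r) (0# ∷ mulP p r)

  eval : Poly → Carrier → Carrier
  eval []      x = 0#
  eval (a ∷ p) x = a + x * eval p x

  HasDegree : Poly → ℕ → Set ℓ
  HasDegree p d = (¬ (coeff p d ≈ 0#)) × (∀ n → d < n → coeff p n ≈ 0#)

  IsZeroP : Poly → Set ℓ
  IsZeroP p = ∀ n → coeff p n ≈ 0#

  IsConstP : Poly → Set ℓ
  IsConstP p = ∀ n → 1 ≤ n → coeff p n ≈ 0#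

  Monic : Poly → Set ℓ
  Monic p = ∃ λ d → HasDegree p d × (coeff p d ≈ 1#)

  MonicIrreducible : Poly → Set (c ⊔ ℓ)
  MonicIrreducible P =
    FqPoly P × Monic P × (¬ IsConstP P) ×
    (∀ A B → FqPoly A → FqPoly B → P ≈ₚ mulP A B → IsConstP A ⊎ IsConstP B)

  -- k = 𝔽_q(T) ⊆ Ω: quotients A(T)/B(T) with A, B ∈ 𝔽_q[T], B(T) ≠ 0
  Ink : Pred Carrier (c ⊔ ℓ)
  Ink x = ∃ λ A → ∃ λ B → FqPoly A × FqPoly B × (¬ (eval B T ≈ 0#)) × (x * eval B T ≈ eval A T)

  IsAlgClosureSetting : Set (c ⊔ ℓ)
  IsAlgClosureSetting =
    IsField ×
    (∃ λ p → ∃ λ n → Prime p × 1 ≤ n × (q ≡ p ^ n) × (natMul p ≈ 0#)) ×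
    (∀ A → FqPoly A → eval A T ≈ 0# → IsZeroP A) ×
    (∀ f → ¬ IsConstP f → ∃ λ x → eval f x ≈ 0#) ×
    (∀ x → ∃ λ f → CoeffsIn Ink f × (¬ IsZeroP f) × (eval f x ≈ 0#))

  -- Carlitz–Hayes action: u^N = N(φ + μ_T)(u), φ(u) = u^q, μ_T(u) = T u
  φ+μ : Carrier → Carrier
  φ+μ u = pow u q + T * u

  -- N = a₀ + X·N'  ⇒  N(f)(u) = a₀ u + N'(f)(f u)
  act : Poly → Carrier → Carrier
  act []      u = 0#
  act (a ∷ N) u = a * u + act N (φ+μ u)

  IsSubfield : Pred Carrier ℓ → Set (c ⊔ ℓ)
  IsSubfield F =
    (∀ {x y} → x ≈ y → F x → F y) ×
    F 0# × F 1# ×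
    (∀ {x y} → F x → F y → F (x + y)) ×
    (∀ {x} → F x → F (- x)) ×
    (∀ {x y} → F x → F y → F (x * y)) ×
    (∀ {x y} → F x → x * y ≈ 1# → F y)

  _⊆_ : {a b : Level} → Pred Carrier a → Pred Carrier b → Set (c ⊔ a ⊔ b)
  A ⊆ B = ∀ {x} → A x → B x

  Pure : (F₂ F₁ : Pred Carrier ℓ) → Set (c ⊔ ℓ)
  Pure F₂ F₁ = ∀ P → MonicIrreducible P → ∀ u → F₂ u → act P u ≈ 0# → F₁ u

{-# OPTIONS --safe #-}
module Submission where

open import Defs
open import Level using (Level)
open import Data.Nat using (ℕ)
open import Data.Product using (_×_; _,_)
open import Relation.Unary using (Pred)
open import Algebra.Bundles using (CommutativeRing)
open import Function.Bundles using (_⇔_; mk⇔)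

-- Purity only concerns where torsion points lie, so it is transitive in a tower and
-- may be weakened by enlarging the base field or shrinking the top field.
module PureProperties {c ℓ : Level} (Ω : CommutativeRing c ℓ) (q : ℕ) (T : CommutativeRing.Carrier Ω) where
  open CommutativeRing Ω using (Carrier)
  open Carlitz Ω q T

  Pure-trans : {K L L' : Pred Carrier ℓ} → Pure L' L → Pure L K → Pure L' K
  Pure-trans L'/L L/K P irr u u∈L' Pu≈0 = L/K P irr u (L'/L P irr u u∈L' Pu≈0) Pu≈0

  Pure-weakenBase : {K L L' : Pred Carrier ℓ} → K ⊆ L → Pure L' K → Pure L' L
  Pure-weakenBase K⊆L L'/K P irr u u∈L' Pu≈0 = K⊆L (L'/K P irr u u∈L' Pu≈0)

  Pure-restrictTop : {K L L' : Pred Carrier ℓ} → L ⊆ L' → Pure L' K → Pure L K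
  Pure-restrictTop L⊆L' L'/K P irr u u∈L Pu≈0 = L'/K P irr u (L⊆L' u∈L) Pu≈0

mainTheorem18 : {c ℓ : Level} (Ω : CommutativeRing c ℓ) (q : ℕ) (T : CommutativeRing.Carrier Ω) →
    let open Carlitz Ω q T in
    IsAlgClosureSetting →
    (K L L' : Pred (CommutativeRing.Carrier Ω) ℓ) →
    IsSubfield K → IsSubfield L → IsSubfield L' →
    Ink ⊆ K → K ⊆ L → L ⊆ L' →
    Pure L' K ⇔ (Pure L' L × Pure L K)
mainTheorem18 Ω q T _ K L L' _ _ _ _ K⊆L L⊆L' = mk⇔
  (λ L'/K → Pure-weakenBase K⊆L L'/K , Pure-restrictTop L⊆L' L'/K)
  (λ (L'/L , L/K) → Pure-trans L'/L L/K)
  where open PureProperties Ω q T
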